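{- Let $T$ be an oriented tree such that: $T$ is grounded; the set $U=\{v\in V(T):\deg^-(v)\geq 2\}$ has $|U|\geq 2$; the minimal subtree $T'$ of $T$ containing $U$ is an out-arborescence; and $T$ has no leaf of in-degree $1$. Then there exist integers $k,\ell$ such that $T$ is a subgraph of $T(k,\ell)$.
   Context: An oriented tree is an orientation of an undirected tree. The height function of $T$ is $h_T\colon V(T)\to\mathbb{Z}$ with $h_T(v)=h_T(u)+1$ for every edge $(u,v)$; $T$ is grounded if $h_T$ is constant on the vertices of in-degree at least $2$. An out-arborescence is an oriented tree with all edges oriented away from a designated root. $B^+_{k,\ell}$ is the complete $\ell$-ary tree of depth $k$ with all edges oriented away from the root. $S^-_{k,\ell}$ is the $(k-1)$-subdivision of the in-star with $\ell$ leaves, i.e. a centre vertex with $\ell$ directed paths of length $k$ ending at it, pairwise disjoint except at the centre. $T(k,\ell)$ is the oriented tree obtained from $B^+_{k,\ell}$ by identifying each leaf with the centre of a new (disjoint) copy of $S^-_{k,\ell}$. -}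

module Defs where

open import Data.Nat using (ℕ; zero; suc; _≤_; _<_)
open import Data.Integer using (ℤ; _+_; 1ℤ)
open import Data.Fin using (Fin; toℕ)
open import Data.Bool using (Bool; true; false)
open import Data.List using (List; []; _∷_; length; filterᵇ; allFin; _∷ʳ_)
open import Data.List.Relation.Unary.Linked using (Linked)
open import Data.List.Relation.Unary.Unique.Propositional using (Unique)
open import Data.Product using (Σ; ∃; ∃-syntax; _×_; _,_)
open import Data.Sum using (_⊎_)
open import Data.Empty using (⊥)
open import Relation.Nullary using (¬_)
open import Relation.Binary.PropositionalEquality using (_≡_; _≢_)
open import Function.Definitions using (Injective)

record Digraph : Set where
  field
    n   : ℕ
    adj : Fin n → Fin n → Bool

module _ (G : Digraph) where
  open Digraph G

  Arc : Fin n → Fin n → Set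
  Arc u v = adj u v ≡ true

  UAdj : Fin n → Fin n → Set
  UAdj u v = Arc u v ⊎ Arc v u

  indeg : Fin n → ℕ
  indeg v = length (filterᵇ (λ u → adj u v) (allFin n))

  outdeg : Fin n → ℕ
  outdeg u = length (filterᵇ (λ v → adj u v) (allFin n))

  IsOriented : Set
  IsOriented = (∀ v → ¬ Arc v v) × (∀ u v → Arc u v → ¬ Arc v u)

  data UWalk (S : Fin n → Set) : Fin n → Fin n → Set where
    here : ∀ {v} → S v → UWalk S v v
    step : ∀ {u v w} → S u → UAdj u v → UWalk S v w → UWalk S u w

  data DWalk (S : Fin n → Set) : Fin n → Fin n → Set where
    here : ∀ {v} → S v → DWalk S v v
    step : ∀ {u v w} → S u → Arc u v → DWalk S v w → DWalk S u w

  Everything : Fin n → Set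
  Everything _ = Data.Unit.⊤
    where import Data.Unit

  ConnectedOn : (Fin n → Set) → Set
  ConnectedOn S = ∀ u v → S u → S v → UWalk S u v

  -- an (undirected) cycle: at least 3 distinct vertices v ∷ ws, consecutive
  -- ones adjacent, and the last adjacent to the first
  HasCycle : Set
  HasCycle = Σ (Fin n) λ v → Σ (List (Fin n)) λ ws →
               (2 ≤ length ws) × Unique (v ∷ ws) × Linked UAdj ((v ∷ ws) ∷ʳ v)

  IsOrientedTree : Set
  IsOrientedTree = IsOriented × (0 < n) × ConnectedOn Everything × ¬ HasCycle

  U : Fin n → Set
  U v = 2 ≤ indeg v

  IsHeight : (Fin n → ℤ) → Set
  IsHeight h = ∀ u v → Arc u v → h v ≡ h u + 1ℤ

  -- grounded: (a / the, unique up to a constant) height function is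
  -- constant on the vertices of in-degree at least 2
  Grounded : Set
  Grounded = Σ (Fin n → ℤ) λ h → IsHeight h × (∀ u v → U u → U v → h u ≡ h v)

  SubtreeContaining : (Fin n → Set) → (Fin n → Set) → Set
  SubtreeContaining P S = (∀ v → P v → S v) × ConnectedOn S

  MinimalSubtreeContaining : (Fin n → Set) → (Fin n → Set) → Set₁
  MinimalSubtreeContaining P S =
    SubtreeContaining P S × (∀ S′ → SubtreeContaining P S′ → ∀ v → S v → S′ v)

  -- the subgraph induced by S is an out-arborescence: there is a root r in S
  -- from which every vertex of S is reached by a directed path inside S
  -- (i.e. all edges are oriented away from r)
  IsOutArborescenceOn : (Fin n → Set) → Set
  IsOutArborescenceOn S = Σ (Fin n) λ r → S r × (∀ v → S v → DWalk S r v)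

  IsLeafIndeg1 : Fin n → Set
  IsLeafIndeg1 v = indeg v ≡ 1 × outdeg v ≡ 0

-- Vertices of B⁺_{k,ℓ}: words over Fin ℓ of length ≤ k (the root is []),
-- with an arc w → a ∷ w.  Each leaf w (length k) is the centre of a copy of
-- S⁻_{k,ℓ}: for each i : Fin ℓ a directed path of length k ending at w,
-- whose non-centre vertices are  leg w i j  (j : Fin k) at distance
-- toℕ j + 1 from the centre.

data TV (k ℓ : ℕ) : Set where
  inner : (w : List (Fin ℓ)) → length w ≤ k → TV k ℓ
  leg   : (w : List (Fin ℓ)) → length w ≡ k → Fin ℓ → Fin k → TV k ℓ

TArc : ∀ {k ℓ} → TV k ℓ → TV k ℓ → Set
TArc (inner w _) (inner w′ _) = ∃[ a ] (w′ ≡ a ∷ w)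
TArc (inner _ _) (leg _ _ _ _) = ⊥
TArc (leg w _ i j) (inner w′ _) = (w ≡ w′) × (toℕ j ≡ 0)
TArc (leg w _ i j) (leg w′ _ i′ j′) = (w ≡ w′) × (i ≡ i′) × (toℕ j ≡ suc (toℕ j′))

SubgraphOfT : Digraph → ℕ → ℕ → Set
SubgraphOfT G k ℓ = Σ (Fin (Digraph.n G) → TV k ℓ) λ f →
  Injective _≡_ _≡_ f × (∀ u v → Arc G u v → TArc (f u) (f v))

{-# OPTIONS --safe #-}
module Submission where

-- Shifted to ℕ, the height function puts every vertex of U at one height G.  As T has no
-- leaf of in-degree 1, every vertex outside U has an out-neighbour, so all heights are at most
-- G and every vertex has a directed path into U.  Since T is a tree, a vertex with two
-- out-neighbours separates the vertices of U reached from them and so lies in the minimal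
-- subtree S spanned by U.  Let r be the root of S.  The trunk, S together with the ancestors
-- of r, is therefore closed under out-arcs and each of its vertices has at most one
-- in-neighbour in it; listing a trunk vertex and its ancestors embeds the trunk into B⁺, with
-- U going to the leaves.  Every other vertex has one out-neighbour and at most one
-- in-neighbour, so it lies on a directed path ending at a vertex c of U, and it goes to the leg
-- of the in-star at c labelled by the last vertex before c.

open import Defs
open import Data.Nat using (ℕ; zero; suc; _≤_; _<_; z≤n; s≤s; _∸_; _+_; _≤?_)
open import Data.Nat.Properties
  using (≤-refl; ≤-trans; ≤-reflexive; ≤-antisym; <-irrefl; ≤-<-trans; <-trans; <⇒≱; ≰⇒>; ≤-pred;
         m≤n⇒m≤1+n; ≤∧≢⇒<; +-suc; +-comm; +-identityʳ; +-monoʳ-≤; n≤1+n; m≤n+m;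
         n∸n≡0; m∸n≤m; +-∸-assoc; m+[n∸m]≡n)
open import Data.Integer as ℤ using (ℤ; +_; ∣_∣; 1ℤ)
import Data.Integer.Properties as ℤ
open import Algebra.Properties.CommutativeSemigroup ℤ.+-commutativeSemigroup using (xy∙z≈xz∙y)
open import Data.Fin using (Fin; toℕ; fromℕ<; _≟_)
open import Data.Fin.Properties using (any?; toℕ-fromℕ<)
open import Data.Bool using (T; T?; true) renaming (_≟_ to _≟ᵇ_)
open import Data.Bool.Properties using (T-≡)
open import Data.List using (List; []; _∷_; length; filter; allFin; iterate; _∷ʳ_)
open import Data.List.Properties using (filter-none; length-iterate; ∷-injectiveˡ)
open import Data.List.Relation.Unary.Linked using (Linked; [-]; _∷_)
open import Data.List.Relation.Unary.Unique.Propositional using (Unique)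
open import Data.List.Relation.Unary.AllPairs using ([]; _∷_)
open import Data.List.Relation.Unary.All as All using (All; []; _∷_)
open import Data.List.Relation.Unary.All.Properties using (¬Any⇒All¬)
open import Data.List.Relation.Unary.Any using (here; there)
open import Data.List.Membership.Propositional using (_∈_)
open import Data.List.Membership.Propositional.Properties using (∈-allFin; ∈-filter⁺)
import Data.List.Membership.DecPropositional as DecMembership
import Data.List.Extrema
import Data.List.Extrema.Nat as ℕExtrema
open import Data.Product using (Σ; ∃; _×_; _,_; proj₁; proj₂)
open import Data.Sum using (_⊎_; inj₁; inj₂; swap)
open import Data.Empty using (⊥-elim)
open import Data.Unit using (tt)
open import Function using (_∘_; Equivalence)
open import Relation.Nullary using (¬_; Dec; yes; no)
open import Relation.Nullary.Decidable using (map′; _×-dec_; _⊎-dec_)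
open import Relation.Unary using (Decidable)
open import Relation.Binary.PropositionalEquality
  using (_≡_; _≢_; refl; sym; trans; cong; cong₂; cong-app; subst; module ≡-Reasoning)

module _ {n : ℕ} {P : Fin n → Set} (P? : Decidable P) where

  pick : Fin n → Fin n
  pick d with any? P?
  ... | yes (x , _) = x
  ... | no _        = d

  pick-sound : ∀ d {x} → P x → P (pick d)
  pick-sound d {x} px with any? P?
  ... | yes (_ , py) = py
  ... | no ∄         = ⊥-elim (∄ (x , px))

  pick-or-default : ∀ d → P (pick d) ⊎ pick d ≡ d
  pick-or-default d with any? P?
  ... | yes (_ , py) = inj₁ py
  ... | no _         = inj₂ refl

module _ {A : Set} where
  open import Function.Endo.Propositional A using (_^_; ^-homo)

  ^-suc : ∀ (f : A → A) t x → (f ^ suc t) x ≡ (f ^ t) (f x)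
  ^-suc f t x = subst (λ m → (f ^ m) x ≡ (f ^ t) (f x)) (+-comm t 1) (cong-app (^-homo f t 1) x)

∈⇒1≤length : ∀ {A : Set} {a : A} {xs} → a ∈ xs → 1 ≤ length xs
∈⇒1≤length (here _)  = s≤s z≤n
∈⇒1≤length (there _) = s≤s z≤n

∈-≢-∈⇒2≤length : ∀ {A : Set} {a b : A} {xs} → a ∈ xs → b ∈ xs → a ≢ b → 2 ≤ length xs
∈-≢-∈⇒2≤length (here refl) (here refl) a≢b = ⊥-elim (a≢b refl)
∈-≢-∈⇒2≤length (here refl) (there b∈)  _   = s≤s (∈⇒1≤length b∈)
∈-≢-∈⇒2≤length (there a∈)  (here refl) _   = s≤s (∈⇒1≤length a∈)
∈-≢-∈⇒2≤length (there a∈)  (there b∈)  a≢b = m≤n⇒m≤1+n (∈-≢-∈⇒2≤length a∈ b∈ a≢b)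

module Degrees (G : Digraph) where
  open Digraph G

  private
    arc-into? : ∀ v → Decidable (λ u → T (adj u v))
    arc-into? v u = T? (adj u v)

    in-neighbours-of : ∀ {u v} → Arc G u v → u ∈ filter (arc-into? v) (allFin n)
    in-neighbours-of {u} a = ∈-filter⁺ (arc-into? _) (∈-allFin u) (Equivalence.from T-≡ a)

  arc⇒1≤indeg : ∀ {u v} → Arc G u v → 1 ≤ indeg G v
  arc⇒1≤indeg a = ∈⇒1≤length (in-neighbours-of a)

  two-in-arcs⇒U : ∀ {u w v} → u ≢ w → Arc G u v → Arc G w v → U G v
  two-in-arcs⇒U u≢w a b = ∈-≢-∈⇒2≤length (in-neighbours-of a) (in-neighbours-of b) u≢w

  ¬U⇒in-unique : ∀ {u w v} → ¬ U G v → Arc G u v → Arc G w v → u ≡ w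
  ¬U⇒in-unique {u} {w} ¬Uv a b with u ≟ w
  ... | yes u≡w = u≡w
  ... | no  u≢w = ⊥-elim (¬Uv (two-in-arcs⇒U u≢w a b))

  sink⇒leaf : ConnectedOn G (Everything G) → ∀ {v w} → w ≢ v →
              (∀ x → ¬ Arc G v x) → ¬ U G v → IsLeafIndeg1 G v
  sink⇒leaf connected {v} {w} w≢v sink ¬Uv = indeg≡1 , outdeg≡0
    where
    in-arc-towards : ∀ {x} → UWalk G (Everything G) v x → x ≢ v → 1 ≤ indeg G v
    in-arc-towards (here _)                 x≢v = ⊥-elim (x≢v refl)
    in-arc-towards (step _ (inj₁ v→y) _) _   = ⊥-elim (sink _ v→y)
    in-arc-towards (step _ (inj₂ y→v) _) _   = arc⇒1≤indeg y→v

    indeg≡1 : indeg G v ≡ 1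
    indeg≡1 = ≤-antisym (≤-pred (≰⇒> ¬Uv)) (in-arc-towards (connected v w tt tt) w≢v)

    outdeg≡0 : outdeg G v ≡ 0
    outdeg≡0 = cong length (filter-none (T? ∘ adj v) {allFin n}
                 (All.tabulate λ {x} _ t → sink x (Equivalence.to T-≡ t)))

-- Walks in acyclic graphs

module Walks (G : Digraph) where
  open Digraph G using (n)

  private variable
    S R Q : Fin n → Set
    a b c x : Fin n

  vertices : UWalk G S a b → List (Fin n)
  vertices (here {v} _)     = v ∷ []
  vertices (step {u} _ _ w) = u ∷ vertices w

  walk-start : UWalk G S a b → S a
  walk-start (here s)     = s
  walk-start (step s _ _) = s

  walk-end : UWalk G S a b → S b
  walk-end (here s)     = s
  walk-end (step _ _ w) = walk-end w

  start-∈ : (w : UWalk G S a b) → a ∈ vertices w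
  start-∈ (here _)     = here refl
  start-∈ (step _ _ _) = here refl

  end-∈ : (w : UWalk G S a b) → b ∈ vertices w
  end-∈ (here _)     = here refl
  end-∈ (step _ _ w) = there (end-∈ w)

  vertices-All : (w : UWalk G S a b) → All S (vertices w)
  vertices-All (here s)     = s ∷ []
  vertices-All (step s _ w) = s ∷ vertices-All w

  infixr 5 _++ʷ_
  _++ʷ_ : UWalk G S a b → UWalk G S b c → UWalk G S a c
  here _       ++ʷ w′ = w′
  step s ab w  ++ʷ w′ = step s ab (w ++ʷ w′)

  reverseʷ : UWalk G S a b → UWalk G S b a
  reverseʷ (here s)      = here s
  reverseʷ (step s ab w) = reverseʷ w ++ʷ step (walk-start w) (swap ab) (here s)

  restrict : (w : UWalk G S a b) → All R (vertices w) → UWalk G R a b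
  restrict (here _)      (r ∷ []) = here r
  restrict (step _ ab w) (r ∷ rs) = step r ab (restrict w rs)

  mapʷ : (∀ {v} → S v → R v) → UWalk G S a b → UWalk G R a b
  mapʷ f w = restrict w (All.map f (vertices-All w))

  prefix : (w : UWalk G S a b) → c ∈ vertices w → UWalk G (_∈ vertices w) a c
  prefix (here _)      (here refl) = here (here refl)
  prefix (step _ _ _)  (here refl) = here (here refl)
  prefix (step _ ab w) (there c∈)  = step (here refl) ab (mapʷ there (prefix w c∈))

  suffix : (w : UWalk G S a b) → c ∈ vertices w →
           Σ (UWalk G S c b) λ w′ → Unique (vertices w) → Unique (vertices w′)
  suffix w@(here _)     (here refl) = w , λ u → u
  suffix w@(step _ _ _) (here refl) = w , λ u → u
  suffix (step _ _ w)   (there c∈) with suffix w c∈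
  ... | w′ , unique⇒ = w′ , λ { (_ ∷ u) → unique⇒ u }

  simplify : UWalk G S a b → Σ (UWalk G S a b) (Unique ∘ vertices)
  simplify (here s) = here s , [] ∷ []
  simplify {a = a} (step s ab w) with simplify w
  ... | w′ , unique with a ∈? vertices w′
    where open DecMembership (_≟_ {n}) using (_∈?_)
  ...   | yes a∈ = proj₁ (suffix w′ a∈) , proj₂ (suffix w′ a∈) unique
  ...   | no  a∉ = step s ab w′ , ¬Any⇒All¬ _ a∉ ∷ unique

  avoid-or-visit : ∀ x → UWalk G S a b → S x ⊎ UWalk G (_≢ x) a b
  avoid-or-visit {a = a} x (here s) with a ≟ x
  ... | yes refl = inj₁ s
  ... | no  a≢x  = inj₂ (here a≢x)
  avoid-or-visit {a = a} x (step s ab w) with a ≟ x | avoid-or-visit x w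
  ... | yes refl | _        = inj₁ s
  ... | no  _    | inj₁ sx  = inj₁ sx
  ... | no  a≢x  | inj₂ w′  = inj₂ (step a≢x ab w′)

  private
    linked : (w : UWalk G S a b) → UAdj G c a → UAdj G b x →
             Linked (UAdj G) (c ∷ (vertices w ∷ʳ x))
    linked (here _)     ca bx = ca ∷ bx ∷ [-]
    linked (step _ ab w) ca bx = ca ∷ linked w ab bx

  no-detour : ¬ HasCycle G → ∀ {x y z} → y ≢ z → UAdj G x y → UAdj G x z →
              ¬ UWalk G (_≢ x) y z
  no-detour acyclic {x} y≢z xy xz detour with simplify detour
  ... | here _ , _ = y≢z refl
  ... | w@(step _ _ w′) , unique =
        acyclic (x , vertices w , 2≤ w′ , x∉ ∷ unique , linked w xy (swap xz))
    where
    x∉ : All (x ≢_) (vertices w)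
    x∉ = All.map (λ v≢x x≡v → v≢x (sym x≡v)) (vertices-All w)
    2≤ : ∀ {a b} (w′ : UWalk G (_≢ x) a b) → 2 ≤ suc (length (vertices w′))
    2≤ (here _)     = s≤s (s≤s z≤n)
    2≤ (step _ _ _) = s≤s (s≤s z≤n)

  cut-vertex : ¬ HasCycle G → ConnectedOn G S → ∀ {a b x p q} → S a → S b →
               UAdj G x p → UAdj G x q → p ≢ q →
               UWalk G (_≢ x) p a → UWalk G (_≢ x) q b → S x
  cut-vertex acyclic connected {a} {b} {x} sa sb xp xq p≢q pa qb
    with avoid-or-visit x (connected a b sa sb)
  ... | inj₁ sx = sx
  ... | inj₂ ab = ⊥-elim (no-detour acyclic p≢q xp xq (pa ++ʷ ab ++ʷ reverseʷ qb))

  simple-walk-unavoidable : ¬ HasCycle G → (w : UWalk G S a b) → Unique (vertices w) →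
                            c ∈ vertices w → ¬ UWalk G (_≢ c) a b
  simple-walk-unavoidable _ (here _)     _ (here refl) avoiding = walk-start avoiding refl
  simple-walk-unavoidable _ (step _ _ _) _ (here refl) avoiding = walk-start avoiding refl
  simple-walk-unavoidable _ (step _ _ (here _)) _ (there (here refl)) avoiding =
    walk-end avoiding refl
  simple-walk-unavoidable acyclic (step _ ab (step _ bc w)) (a∉ ∷ b∉ ∷ _) (there (here refl))
                          avoiding =
    no-detour acyclic (λ c≡a → All.lookup a∉ (there (start-∈ w)) (sym c≡a)) bc (swap ab)
      (restrict w (All.map (λ b≢v v≡b → b≢v (sym v≡b)) b∉) ++ʷ reverseʷ avoiding)
  simple-walk-unavoidable _ (step _ _ (here _)) _ (there (there ()))
  simple-walk-unavoidable acyclic (step _ ab w@(step _ _ _)) (_ ∷ unique@(b∉ ∷ _)) (there (there c∈))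
                          avoiding =
    simple-walk-unavoidable acyclic w unique (there c∈) (step (All.lookup b∉ c∈) (swap ab) avoiding)

  last-arc : Q a → Arc G a b → DWalk G Q b c → ∃ λ p → Q p × Arc G p c
  last-arc qa ab (here _)       = _ , qa , ab
  last-arc _  _  (step qb bc w) = last-arc qb bc w

m∸n≡1+m∸1+n : ∀ {m n} → n < m → m ∸ n ≡ suc (m ∸ suc n)
m∸n≡1+m∸1+n = +-∸-assoc 1

module ℕHeight (G : Digraph) (h : Fin (Digraph.n G) → ℤ) (h-arc : IsHeight G h)
               (v₀ : Fin (Digraph.n G)) where
  open Digraph G using (n)
  open Data.List.Extrema ℤ.≤-totalOrder using (argmin; f[argmin]≤f[xs])

  private
    c : ℤ
    c = h (argmin h v₀ (allFin n))

    c≤h : ∀ v → c ℤ.≤ h v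
    c≤h v = All.lookup (f[argmin]≤f[xs] {f = h} v₀ (allFin n)) (∈-allFin v)

  height : Fin n → ℕ
  height v = ∣ h v ℤ.- c ∣

  private
    +height : ∀ v → + height v ≡ h v ℤ.- c
    +height v = ℤ.0≤i⇒+∣i∣≡i (ℤ.i≤j⇒0≤j-i (c≤h v))

  height-arc : ∀ {u v} → Arc G u v → height v ≡ suc (height u)
  height-arc {u} {v} a = trans (ℤ.+-injective (begin
      + height v              ≡⟨ +height v ⟩
      h v ℤ.- c               ≡⟨ cong (ℤ._- c) (h-arc u v a) ⟩
      (h u ℤ.+ 1ℤ) ℤ.- c      ≡⟨ xy∙z≈xz∙y (h u) 1ℤ (ℤ.- c) ⟩
      (h u ℤ.- c) ℤ.+ 1ℤ      ≡⟨ cong (ℤ._+ 1ℤ) (sym (+height u)) ⟩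
      + (height u + 1)        ∎)) (+-comm (height u) 1)
    where open ≡-Reasoning

  height-cong : ∀ {u v} → h u ≡ h v → height u ≡ height v
  height-cong = cong (λ z → ∣ z ℤ.- c ∣)

module Graded (G : Digraph) (g : Fin (Digraph.n G) → ℕ)
              (g-arc : ∀ {u v} → Arc G u v → g v ≡ suc (g u)) where
  open Digraph G using (n)

  private variable
    Q : Fin n → Set
    a b x : Fin n

  arc-< : Arc G a b → g a < g b
  arc-< ab = ≤-reflexive (sym (g-arc ab))

  <ᵍ⇒≢ : g a < g b → a ≢ b
  <ᵍ⇒≢ lt refl = <-irrefl refl lt

  DWalk-≤ : DWalk G Q a b → g a ≤ g b
  DWalk-≤ (here _)      = ≤-refl
  DWalk-≤ (step _ ab w) = ≤-trans (n≤1+n _) (≤-trans (arc-< ab) (DWalk-≤ w))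

  DWalk-level : DWalk G Q a b → g a ≡ g b → a ≡ b
  DWalk-level (here _)      _  = refl
  DWalk-level (step _ ab w) eq = ⊥-elim (<-irrefl eq (≤-trans (arc-< ab) (DWalk-≤ w)))

  DWalk-above : g x < g a → DWalk G Q a b → UWalk G (_≢ x) a b
  DWalk-above x<a (here _)      = here (<ᵍ⇒≢ x<a ∘ sym)
  DWalk-above x<a (step _ ab w) =
    step (<ᵍ⇒≢ x<a ∘ sym) (inj₁ ab) (DWalk-above (<-trans x<a (arc-< ab)) w)

  DWalk-below : g b < g x → DWalk G Q a b → UWalk G (_≢ x) a b
  DWalk-below b<x (here _)          = here (<ᵍ⇒≢ b<x)
  DWalk-below b<x w@(step _ ab w′) =
    step (<ᵍ⇒≢ (≤-<-trans (DWalk-≤ w) b<x)) (inj₁ ab) (DWalk-below b<x w′)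

module GroundedTree
  (T : Digraph) (tree : IsOrientedTree T) (grounded : Grounded T)
  (two-U : Σ (Fin (Digraph.n T)) λ u → Σ (Fin (Digraph.n T)) λ v → u ≢ v × U T u × U T v)
  (arborescence : ∀ S → MinimalSubtreeContaining T (U T) S → IsOutArborescenceOn T S)
  (no-leaf : ∀ v → ¬ IsLeafIndeg1 T v)
  where
  open Digraph T
  open Degrees T
  open Walks T
  open import Function.Endo.Propositional (Fin n) using (_^_)
  open DecMembership (_≟_ {n}) using (_∈?_)
  open ≡-Reasoning

  private variable
    u v w x y : Fin n

  _⇝_ : Fin n → Fin n → Set
  a ⇝ b = DWalk T (Everything T) a b

  connected : ConnectedOn T (Everything T)
  connected = proj₁ (proj₂ (proj₂ tree))

  acyclic : ¬ HasCycle T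
  acyclic = proj₂ (proj₂ (proj₂ tree))

  u₀ u₁ : Fin n
  u₀ = proj₁ two-U
  u₁ = proj₁ (proj₂ two-U)

  u₀≢u₁ : u₀ ≢ u₁
  u₀≢u₁ = proj₁ (proj₂ (proj₂ two-U))

  U-u₀ : U T u₀
  U-u₀ = proj₁ (proj₂ (proj₂ (proj₂ two-U)))

  U-u₁ : U T u₁
  U-u₁ = proj₂ (proj₂ (proj₂ (proj₂ two-U)))

  out-arc? : ∀ v → Decidable (Arc T v)
  out-arc? v w = adj v w ≟ᵇ true

  in-arc? : ∀ y → Decidable (λ x → Arc T x y)
  in-arc? y x = adj x y ≟ᵇ true

  U? : ∀ v → Dec (U T v)
  U? v = 2 ≤? indeg T v

  other-than : ∀ v → Σ (Fin n) (_≢ v)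
  other-than v with u₀ ≟ v
  ... | yes refl = u₁ , u₀≢u₁ ∘ sym
  ... | no  u₀≢v = u₀ , u₀≢v

  has-out-arc : ¬ U T v → ∃ (Arc T v)
  has-out-arc {v} ¬Uv with any? (out-arc? v)
  ... | yes out = out
  ... | no  ∄   = ⊥-elim (no-leaf v (sink⇒leaf connected (proj₂ (other-than v))
                                                 (λ x v→x → ∄ (x , v→x)) ¬Uv))

  next : Fin n → Fin n
  next v = pick (out-arc? v) v

  next-arc : ¬ U T v → Arc T v (next v)
  next-arc {v} ¬Uv = pick-sound (out-arc? v) v (proj₂ (has-out-arc ¬Uv))

  open ℕHeight T (proj₁ grounded) (proj₁ (proj₂ grounded)) u₀
    using (height; height-arc; height-cong)
  open Graded T height height-arc

  G : ℕ
  G = height u₀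

  height-U : U T u → height u ≡ G
  height-U Uu = height-cong (proj₂ (proj₂ grounded) _ u₀ Uu U-u₀)

  private
    highest : Fin n
    highest = ℕExtrema.argmax height u₀ (allFin n)

    ≤-highest : ∀ v → height v ≤ height highest
    ≤-highest v = All.lookup (ℕExtrema.f[xs]≤f[argmax] {f = height} u₀ (allFin n)) (∈-allFin v)

  height-≤ : ∀ v → height v ≤ G
  height-≤ v with U? highest
  ... | yes U-highest = subst (height v ≤_) (height-U U-highest) (≤-highest v)
  ... | no ¬U-highest = ⊥-elim (<⇒≱ (arc-< (next-arc ¬U-highest)) (≤-highest _))

  height≡G⇒U : height v ≡ G → U T v
  height≡G⇒U {v} eq with U? v
  ... | yes Uv  = Uv
  ... | no  ¬Uv = ⊥-elim (<⇒≱ (subst (_< height (next v)) eq (arc-< (next-arc ¬Uv)))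
                              (height-≤ (next v)))

  height<G⇒¬U : height v < G → ¬ U T v
  height<G⇒¬U lt Uv = <-irrefl (height-U Uv) lt

  reach-U′ : ∀ t v → G ≤ height v + t → ∃ λ u → U T u × v ⇝ u
  reach-U′ t v G≤ with U? v
  ... | yes Uv = v , Uv , here tt
  reach-U′ zero v G≤ | no ¬Uv =
    ⊥-elim (¬Uv (height≡G⇒U (≤-antisym (height-≤ v) (subst (G ≤_) (+-identityʳ _) G≤))))
  reach-U′ (suc t) v G≤ | no ¬Uv with reach-U′ t (next v) G≤next
    where
    G≤next : G ≤ height (next v) + t
    G≤next = subst (G ≤_) (trans (+-suc _ t) (cong (_+ t) (sym (height-arc (next-arc ¬Uv))))) G≤
  ... | u , Uu , next⇝u = u , Uu , step tt (next-arc ¬Uv) next⇝u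

  reach-U : ∀ v → ∃ λ u → U T u × v ⇝ u
  reach-U v = reach-U′ G v (m≤n+m G (height v))

  path-to : ∀ u → UWalk T (Everything T) u₀ u
  path-to u = proj₁ (simplify (connected u₀ u tt tt))

  path-to-simple : ∀ u → Unique (vertices (path-to u))
  path-to-simple u = proj₂ (simplify (connected u₀ u tt tt))

  S : Fin n → Set
  S v = ∃ λ u → U T u × v ∈ vertices (path-to u)

  S? : ∀ v → Dec (S v)
  S? v = any? (λ u → U? u ×-dec v ∈? vertices (path-to u))

  U⊆S : U T u → S u
  U⊆S {u} Uu = u , Uu , end-∈ (path-to u)

  S-connected : ConnectedOn T S
  S-connected a b (u , Uu , a∈) (u′ , Uu′ , b∈) = reverseʷ (from-u₀ Uu a∈) ++ʷ from-u₀ Uu′ b∈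
    where
    from-u₀ : ∀ {u v} → U T u → v ∈ vertices (path-to u) → UWalk T S u₀ v
    from-u₀ Uu v∈ = mapʷ (λ w∈ → _ , Uu , w∈) (prefix (path-to _) v∈)

  S-minimal : ∀ S′ → SubtreeContaining T (U T) S′ → ∀ v → S v → S′ v
  S-minimal S′ (U⊆S′ , S′-connected) v (u , Uu , v∈)
    with avoid-or-visit v (S′-connected u₀ u (U⊆S′ u₀ U-u₀) (U⊆S′ u Uu))
  ... | inj₁ S′v      = S′v
  ... | inj₂ avoiding =
    ⊥-elim (simple-walk-unavoidable acyclic (path-to u) (path-to-simple u) v∈ avoiding)

  S-arborescence : IsOutArborescenceOn T S
  S-arborescence = arborescence S (((λ _ → U⊆S) , S-connected) , S-minimal)

  r : Fin n
  r = proj₁ S-arborescence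

  r∈S : S r
  r∈S = proj₁ (proj₂ S-arborescence)

  root-walk : S v → DWalk T S r v
  root-walk = proj₂ (proj₂ S-arborescence) _

  r<G : height r < G
  r<G = ≤∧≢⇒< (height-≤ r) (λ eq → u₀≢u₁ (trans (sym (r≡ U-u₀ eq)) (r≡ U-u₁ eq)))
    where
    r≡ : U T u → height r ≡ G → r ≡ u
    r≡ Uu eq = DWalk-level (root-walk (U⊆S Uu)) (trans eq (sym (height-U Uu)))

  S-out-closed : S x → Arc T x y → S y
  S-out-closed {x} {y} sx x→y with U? y
  ... | yes Uy  = U⊆S Uy
  ... | no  ¬Uy with reach-U (next y)
  ...   | u , Uu , next⇝u =
    cut-vertex acyclic S-connected sx (U⊆S Uu) (inj₂ x→y) (inj₁ y→next)
      (<ᵍ⇒≢ (<-trans (arc-< x→y) (arc-< y→next))) (here (<ᵍ⇒≢ (arc-< x→y)))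
      (DWalk-above (arc-< y→next) next⇝u)
    where
    y→next : Arc T y (next y)
    y→next = next-arc ¬Uy

  out-unique : ¬ S x → Arc T x y → Arc T x w → y ≡ w
  out-unique {x} {y} {w} ¬Sx x→y x→w with y ≟ w | reach-U y | reach-U w
  ... | yes y≡w | _ | _ = y≡w
  ... | no  y≢w | u , Uu , y⇝u | u′ , Uu′ , w⇝u′ =
    ⊥-elim (¬Sx (cut-vertex acyclic S-connected (U⊆S Uu) (U⊆S Uu′) (inj₁ x→y) (inj₁ x→w) y≢w
                   (DWalk-above (arc-< x→y) y⇝u) (DWalk-above (arc-< x→w) w⇝u′)))

  -- The trunk

  in-neighbour : Fin n → Fin n
  in-neighbour y = pick (in-arc? y) y

  in-neighbour-unique : ¬ U T y → Arc T x y → in-neighbour y ≡ x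
  in-neighbour-unique {y} ¬Uy x→y = ¬U⇒in-unique ¬Uy (pick-sound (in-arc? y) y x→y) x→y

  in-neighbour-chain : ∀ t → (in-neighbour ^ t) r ⇝ r
  in-neighbour-chain zero = here tt
  in-neighbour-chain (suc t)
    with pick-or-default (in-arc? ((in-neighbour ^ t) r)) ((in-neighbour ^ t) r)
  ... | inj₁ arc = step tt arc (in-neighbour-chain t)
  ... | inj₂ eq  = subst (_⇝ r) (sym eq) (in-neighbour-chain t)

  ancestor⇒chain : v ⇝ r → (in-neighbour ^ (height r ∸ height v)) r ≡ v
  ancestor⇒chain (here _) = cong (λ t → (in-neighbour ^ t) r) (n∸n≡0 (height r))
  ancestor⇒chain {v} (step {v = w} _ v→w w⇝r) = begin
    (in-neighbour ^ (height r ∸ height v)) r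
      ≡⟨ cong (λ t → (in-neighbour ^ t) r) r∸v ⟩
    in-neighbour ((in-neighbour ^ (height r ∸ height w)) r)
      ≡⟨ cong in-neighbour (ancestor⇒chain w⇝r) ⟩
    in-neighbour w
      ≡⟨ in-neighbour-unique ¬Uw v→w ⟩
    v ∎
    where
    r∸v : height r ∸ height v ≡ suc (height r ∸ height w)
    r∸v = trans (m∸n≡1+m∸1+n (≤-trans (arc-< v→w) (DWalk-≤ w⇝r)))
                (cong (λ h → suc (height r ∸ h)) (sym (height-arc v→w)))
    ¬Uw : ¬ U T w
    ¬Uw = height<G⇒¬U (≤-<-trans (DWalk-≤ w⇝r) r<G)

  -- Ancestors of r lie below U, so their in-neighbours are unique: v is an ancestor
  -- iff it is reached from r by height r ∸ height v in-neighbour steps.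
  ancestor? : ∀ v → Dec (v ⇝ r)
  ancestor? v = map′ (λ eq → subst (_⇝ r) eq (in-neighbour-chain t)) ancestor⇒chain
                     ((in-neighbour ^ t) r ≟ v)
    where t = height r ∸ height v

  Trunk : Fin n → Set
  Trunk v = S v ⊎ v ⇝ r

  Leg : Fin n → Set
  Leg v = ¬ Trunk v

  Trunk? : ∀ v → Dec (Trunk v)
  Trunk? v = S? v ⊎-dec ancestor? v

  U⊆Trunk : U T v → Trunk v
  U⊆Trunk = inj₁ ∘ U⊆S

  Leg⇒¬U : Leg v → ¬ U T v
  Leg⇒¬U lv = lv ∘ U⊆Trunk

  ancestor-out : x ⇝ r → Arc T x y → Trunk y
  ancestor-out (here _) r→y = inj₁ (S-out-closed r∈S r→y)
  ancestor-out {x} {y} (step {v = z} _ x→z z⇝r) x→y with y ≟ z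
  ... | yes refl = inj₂ z⇝r
  ... | no  y≢z with reach-U y
  ...   | u , Uu , y⇝u = inj₁ (S-out-closed x∈S x→y)
    where
    x∈S : S x
    x∈S = cut-vertex acyclic S-connected r∈S (U⊆S Uu) (inj₁ x→z) (inj₁ x→y) (y≢z ∘ sym)
            (DWalk-above (arc-< x→z) z⇝r) (DWalk-above (arc-< x→y) y⇝u)

  Trunk-out-closed : Trunk x → Arc T x y → Trunk y
  Trunk-out-closed (inj₁ sx)  = inj₁ ∘ S-out-closed sx
  Trunk-out-closed (inj₂ x⇝r) = ancestor-out x⇝r

  trunk-in-neighbour : ¬ U T y → Arc T x y → Trunk y → Trunk x
  trunk-in-neighbour _ x→y (inj₂ y⇝r) = inj₂ (step tt x→y y⇝r)
  trunk-in-neighbour ¬Uy x→y (inj₁ sy) with root-walk sy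
  ... | here _ = inj₂ (step tt x→y (here tt))
  ... | step sr r→z z⇝y with last-arc sr r→z z⇝y
  ...   | p , sp , p→y = inj₁ (subst S (¬U⇒in-unique ¬Uy p→y x→y) sp)

  leg-into-trunk⇒U : Leg x → Arc T x y → Trunk y → U T y
  leg-into-trunk⇒U {y = y} lx x→y ty with U? y
  ... | yes Uy  = Uy
  ... | no  ¬Uy = ⊥-elim (lx (trunk-in-neighbour ¬Uy x→y ty))

  trunk-walk-below : Trunk x → height x < height y → height r < height y → UWalk T (_≢ y) x r
  trunk-walk-below (inj₁ sx)  x<y _   = reverseʷ (DWalk-below x<y (root-walk sx))
  trunk-walk-below (inj₂ x⇝r) _   r<y = DWalk-below r<y x⇝r

  trunk-in-unique : Trunk x → Trunk w → Arc T x y → Arc T w y → x ≡ w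
  trunk-in-unique {x} {w} {y} tx tw x→y w→y with U? y | x ≟ w
  ... | no  ¬Uy | _       = ¬U⇒in-unique ¬Uy x→y w→y
  ... | yes _   | yes x≡w = x≡w
  ... | yes Uy  | no  x≢w =
    ⊥-elim (no-detour acyclic x≢w (inj₂ x→y) (inj₂ w→y) (below tx x→y ++ʷ reverseʷ (below tw w→y)))
    where
    below : ∀ {v} → Trunk v → Arc T v y → UWalk T (_≢ y) v r
    below tv v→y = trunk-walk-below tv (arc-< v→y) (subst (height r <_) (sym (height-U Uy)) r<G)

  -- At the top of the trunk parent falls back to its argument, so a word may end in
  -- repetitions of the top vertex; this is harmless.
  parent : Fin n → Fin n
  parent y = pick (λ x → in-arc? y x ×-dec Trunk? x) y

  parent-arc : Trunk x → Arc T x y → parent y ≡ x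
  parent-arc tx x→y = trunk-in-unique (proj₂ chosen) tx (proj₁ chosen) x→y
    where chosen = pick-sound (λ x → in-arc? _ x ×-dec Trunk? x) _ (x→y , tx)

  word : Fin n → List (Fin n)
  word v = iterate parent v (suc (height v))

  word-arc : Trunk x → Arc T x y → word y ≡ y ∷ word x
  word-arc {x} {y} tx x→y = begin
    iterate parent y (suc (height y))
      ≡⟨ cong (λ h → iterate parent y (suc h)) (height-arc x→y) ⟩
    y ∷ iterate parent (parent y) (suc (height x))
      ≡⟨ cong (λ p → y ∷ iterate parent p (suc (height x))) (parent-arc tx x→y) ⟩
    y ∷ word x ∎

  -- Legs

  depth : Fin n → ℕ
  depth v = G ∸ suc (height v)

  top : Fin n → Fin n
  top v = (next ^ depth v) v

  centre : Fin n → Fin n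
  centre v = next (top v)

  leg-height<G : Leg v → height v < G
  leg-height<G {v} lv = ≤∧≢⇒< (height-≤ v) (Leg⇒¬U lv ∘ height≡G⇒U)

  depth-fits : Leg v → height v + depth v < G
  depth-fits lv = ≤-reflexive (m+[n∸m]≡n (leg-height<G lv))

  leg-step : Leg x → Arc T x y → height y < G → Leg y
  leg-step lx x→y y<G ty = height<G⇒¬U y<G (leg-into-trunk⇒U lx x→y ty)

  leg-iterate : ∀ t → Leg v → height v + t < G →
                Leg ((next ^ t) v) × height ((next ^ t) v) ≡ height v + t
  leg-iterate zero lv _ = lv , sym (+-identityʳ _)
  leg-iterate {v} (suc t) lv v<G
    with leg-iterate t lv (≤-<-trans (+-monoʳ-≤ (height v) (n≤1+n t)) v<G)
  ... | lw , hw = leg-step lw arc (subst (_< G) (sym hz) v<G) , hz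
    where
    arc : Arc T ((next ^ t) v) ((next ^ suc t) v)
    arc = next-arc (Leg⇒¬U lw)
    hz : height ((next ^ suc t) v) ≡ height v + suc t
    hz = trans (height-arc arc) (trans (cong suc hw) (sym (+-suc (height v) t)))

  iterate-injective : ∀ t → Leg v → Leg w → height v + t < G → height w + t < G →
                      (next ^ t) v ≡ (next ^ t) w → v ≡ w
  iterate-injective zero _ _ _ _ eq = eq
  iterate-injective {v} {w} (suc t) lv lw v<G w<G eq =
    iterate-injective t lv lw (shrink v<G) (shrink w<G)
      (¬U⇒in-unique ¬U-next (arc lv v<G) (subst (Arc T _) (sym eq) (arc lw w<G)))
    where
    shrink : ∀ {u} → height u + suc t < G → height u + t < G
    shrink {u} = ≤-<-trans (+-monoʳ-≤ (height u) (n≤1+n t))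
    arc : ∀ {u} → Leg u → height u + suc t < G → Arc T ((next ^ t) u) ((next ^ suc t) u)
    arc lu u<G = next-arc (Leg⇒¬U (proj₁ (leg-iterate t lu (shrink u<G))))
    ¬U-next : ¬ U T ((next ^ suc t) v)
    ¬U-next = Leg⇒¬U (proj₁ (leg-iterate (suc t) lv v<G))

  leg-next : Leg x → Arc T x y → next x ≡ y
  leg-next lx = out-unique (lx ∘ inj₁) (next-arc (Leg⇒¬U lx))

  leg-into-leg : Leg x → Arc T x y → Leg y → depth x ≡ suc (depth y) × top x ≡ top y
  leg-into-leg {x} {y} lx x→y ly = depth≡ , (begin
    (next ^ depth x) x        ≡⟨ cong (λ t → (next ^ t) x) depth≡ ⟩
    (next ^ suc (depth y)) x  ≡⟨ ^-suc next (depth y) x ⟩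
    (next ^ depth y) (next x) ≡⟨ cong (next ^ depth y) (leg-next lx x→y) ⟩
    (next ^ depth y) y        ∎)
    where
    depth≡ : depth x ≡ suc (depth y)
    depth≡ = trans (cong (G ∸_) (sym (height-arc x→y))) (m∸n≡1+m∸1+n (leg-height<G ly))

  leg-into-trunk : Leg x → Arc T x y → Trunk y → depth x ≡ 0 × centre x ≡ y × height y ≡ G
  leg-into-trunk {x} {y} lx x→y ty = depth≡0 , centre≡y , y-height
    where
    y-height : height y ≡ G
    y-height = height-U (leg-into-trunk⇒U lx x→y ty)
    depth≡0 : depth x ≡ 0
    depth≡0 = trans (cong (G ∸_) (trans (sym (height-arc x→y)) y-height)) (n∸n≡0 G)
    centre≡y : centre x ≡ y
    centre≡y = trans (cong (λ t → next ((next ^ t) x)) depth≡0)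
                     (leg-next lx x→y)

  k : ℕ
  k = suc G

  leg-index : Fin n → Fin k
  leg-index v = fromℕ< (s≤s (m∸n≤m G (suc (height v))))

  toℕ-leg-index : ∀ v → toℕ (leg-index v) ≡ depth v
  toℕ-leg-index v = toℕ-fromℕ< (s≤s (m∸n≤m G (suc (height v))))

  -- A leg vertex v goes to the in-star at centre v, on the leg labelled by the vertex top v
  -- (hence ℓ = n), at distance depth v + 1 from the centre.
  embed′ : ∀ v → Dec (Trunk v) → TV k n
  embed′ v (yes _) = inner (word v)
                          (subst (_≤ k) (sym (length-iterate parent v _)) (s≤s (height-≤ v)))
  embed′ v (no  _) = leg (iterate parent (centre v) k) (length-iterate parent (centre v) k)
                         (top v) (leg-index v)

  embed : Fin n → TV k n
  embed v = embed′ v (Trunk? v)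

  embed-arc′ : (dx : Dec (Trunk x)) (dy : Dec (Trunk y)) →
               Arc T x y → TArc (embed′ x dx) (embed′ y dy)
  embed-arc′ {y = y} (yes tx) (yes _) x→y = y , word-arc tx x→y
  embed-arc′ (yes tx) (no ly) x→y = ly (Trunk-out-closed tx x→y)
  embed-arc′ {x} (no lx) (yes ty) x→y with leg-into-trunk lx x→y ty
  ... | depth≡0 , centre≡y , y-height =
    cong₂ (λ c h → iterate parent c (suc h)) centre≡y (sym y-height) ,
    trans (toℕ-leg-index x) depth≡0
  embed-arc′ {x} {y} (no lx) (no ly) x→y with leg-into-leg lx x→y ly
  ... | depth≡ , top≡ =
    cong (λ z → iterate parent (next z) k) top≡ , top≡ ,
    trans (toℕ-leg-index x) (trans depth≡ (cong suc (sym (toℕ-leg-index y))))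

  inner-word-injective : ∀ {w w′ : List (Fin n)} {p p′} → inner {k} w p ≡ inner w′ p′ → w ≡ w′
  inner-word-injective refl = refl

  leg-label-injective : ∀ {w w′ : List (Fin n)} {e e′ i i′ j j′} →
                  leg {k} w e i j ≡ leg w′ e′ i′ j′ → i ≡ i′ × j ≡ j′
  leg-label-injective refl = refl , refl

  legs-injective : Leg v → Leg w → top v ≡ top w → depth v ≡ depth w → v ≡ w
  legs-injective {v} {w} lv lw top≡ depth≡ =
    iterate-injective (depth v) lv lw (depth-fits lv)
      (subst (λ d → height w + d < G) (sym depth≡) (depth-fits lw))
      (subst (λ d → top v ≡ (next ^ d) w) (sym depth≡) top≡)

  embed-injective′ : (dv : Dec (Trunk v)) (dw : Dec (Trunk w)) → embed′ v dv ≡ embed′ w dw → v ≡ w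
  embed-injective′ (yes _) (yes _) eq = ∷-injectiveˡ (inner-word-injective eq)
  embed-injective′ (yes _) (no  _) ()
  embed-injective′ (no  _) (yes _) ()
  embed-injective′ {v} {w} (no lv) (no lw) eq with leg-label-injective eq
  ... | top≡ , j≡ =
    legs-injective lv lw top≡ (trans (sym (toℕ-leg-index v)) (trans (cong toℕ j≡) (toℕ-leg-index w)))

  embedding : SubgraphOfT T k n
  embedding = embed , (λ {v} {w} → embed-injective′ (Trunk? v) (Trunk? w)) ,
              (λ x y → embed-arc′ (Trunk? x) (Trunk? y))

lemma3p1 : (T : Digraph) → IsOrientedTree T → Grounded T
           → (Σ (Fin (Digraph.n T)) λ u → Σ (Fin (Digraph.n T)) λ v → u ≢ v × U T u × U T v)
           → (∀ S → MinimalSubtreeContaining T (U T) S → IsOutArborescenceOn T S)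
           → (∀ v → ¬ IsLeafIndeg1 T v)
           → Σ ℕ λ k → Σ ℕ λ ℓ → SubgraphOfT T k ℓ
lemma3p1 T tree grounded two-U arborescence no-leaf = k , Digraph.n T , embedding
  where open GroundedTree T tree grounded two-U arborescence no-leaf using (k; embedding)
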